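{- Let $\Gamma$ be a graph with maximum degree three and let $R$ be the set of removable vertices of $\Gamma$. For every $u \in R$, the set of removable vertices of $\Gamma - u$ is $R \setminus \{u\}$.
   Context: In a graph $\Gamma$ of maximum degree three, a vertex $u$ is removable when $u$ has degree two, and its two neighbours are adjacent, both have degree three, and have exactly one common neighbour. -}

module Defs where

open import Data.Nat using (ℕ; suc; _≤_)
open import Data.Bool using (Bool; true; false; if_then_else_; _∧_)
open import Data.Fin using (Fin; punchIn)
open import Data.List using (List; map; allFin)
open import Data.Nat.ListAction using (sum)
open import Data.Product using (Σ; ∃; ∃-syntax; _×_)
open import Relation.Binary.PropositionalEquality using (_≡_)

record Graph (n : ℕ) : Set where
  field
    adj   : Fin n → Fin n → Bool
    sym   : ∀ v w → adj v w ≡ adj w v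
    irrefl : ∀ v → adj v v ≡ false
open Graph public

countB : {n : ℕ} → (Fin n → Bool) → ℕ
countB {n} p = sum (map (λ w → if p w then 1 else 0) (allFin n))

degree : {n : ℕ} → Graph n → Fin n → ℕ
degree G v = countB (adj G v)

commonNbrs : {n : ℕ} → Graph n → Fin n → Fin n → ℕ
commonNbrs G a b = countB (λ w → adj G a w ∧ adj G b w)

MaxDegree≤3 : {n : ℕ} → Graph n → Set
MaxDegree≤3 G = ∀ v → degree G v ≤ 3

Removable : {n : ℕ} → Graph n → Fin n → Set
Removable G u =
  degree G u ≡ 2 ×
  ∃[ a ] ∃[ b ]
    (adj G u a ≡ true × adj G u b ≡ true × adj G a b ≡ true ×
     degree G a ≡ 3 × degree G b ≡ 3 × commonNbrs G a b ≡ 1)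

-- Γ - u : vertex-deleted (induced) subgraph; vertex v of Γ - u is
-- the vertex punchIn u v of Γ (all vertices other than u).
delete : {n : ℕ} → Graph (suc n) → Fin (suc n) → Graph n
delete G u = record
  { adj = λ v w → adj G (punchIn u v) (punchIn u w)
  ; sym = λ v w → sym G (punchIn u v) (punchIn u w)
  ; irrefl = λ v → irrefl G (punchIn u v)
  }

-- The neighbours of u are exactly a and b, both of degree 3.
-- Deleting u therefore leaves degrees and common-neighbour counts unchanged at all
-- vertices not adjacent to u, and it suffices to see that removability of a vertex
-- v ≠ u, in Γ or in Γ - u, forces v and its two neighbours c, d to avoid a and b.
-- In Γ: v has degree 2, so v ∉ {a, b}; if c = a, the neighbours of a are u, b, v, so
-- the triangle v c d forces d = b, making v a second common neighbour of a and b.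
-- In Γ - u: c and d have degree 3 there, so with maximum degree three they miss u;
-- and if v = a, then b is a neighbour of v in Γ - u adjacent to u, hence neither c nor d.
module Submission where

open import Defs
open import Algebra.Properties.CommutativeSemigroup using (x∙yz≈y∙xz)
open import Data.Bool using (Bool; true; false; if_then_else_; _∧_)
open import Data.Bool.Properties using (∧-comm; ¬-not; not-¬)
open import Data.Empty using (⊥)
open import Data.Fin using (Fin; zero; suc; punchIn; punchOut; _≟_)
open import Data.Fin.Properties using (punchIn-punchOut; punchOut-injective; punchInᵢ≢i)
open import Data.List using (allFin)
open import Data.List.Properties using (map-tabulate; map-cong)
open import Data.Nat using (ℕ; suc; _+_; _≤_)
open import Data.Nat.ListAction using (sum)
open import Data.Nat.Properties using (+-commutativeSemigroup; suc-injective; 1+n≢0; n≮n)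
open import Data.Product using (∃-syntax; _×_; _,_)
open import Data.Sum using (_⊎_; inj₁; inj₂)
import Data.Sum as Sum
open import Function using (_∘_; id)
open import Function.Bundles using (_⇔_; mk⇔)
open import Relation.Nullary using (yes; no; contradiction)
open import Relation.Binary.PropositionalEquality as ≡ using (_≡_; _≢_; _≗_; refl; cong; subst)
open ≡.≡-Reasoning

indicator : Bool → ℕ
indicator b = if b then 1 else 0

countB-suc : ∀ {n} (p : Fin (suc n) → Bool) → countB p ≡ indicator (p zero) + countB (p ∘ suc)
countB-suc p = cong (λ xs → indicator (p zero) + sum xs)
  (≡.trans (map-tabulate suc (indicator ∘ p)) (≡.sym (map-tabulate id (indicator ∘ p ∘ suc))))

countB-punchIn : ∀ {n} (p : Fin (suc n) → Bool) x →
                 countB p ≡ indicator (p x) + countB (p ∘ punchIn x)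
countB-punchIn p zero = countB-suc p
countB-punchIn {suc n} p (suc x) = begin
  countB p
    ≡⟨ countB-suc p ⟩
  indicator (p zero) + countB (p ∘ suc)
    ≡⟨ cong (indicator (p zero) +_) (countB-punchIn (p ∘ suc) x) ⟩
  indicator (p zero) + (indicator (p (suc x)) + countB (p ∘ suc ∘ punchIn x))
    ≡⟨ x∙yz≈y∙xz +-commutativeSemigroup (indicator (p zero)) (indicator (p (suc x))) _ ⟩
  indicator (p (suc x)) + (indicator (p zero) + countB (p ∘ suc ∘ punchIn x))
    ≡⟨ cong (indicator (p (suc x)) +_) (≡.sym (countB-suc (p ∘ punchIn (suc x)))) ⟩
  indicator (p (suc x)) + countB (p ∘ punchIn (suc x))
    ∎

countB-punchIn-false : ∀ {n} (p : Fin (suc n) → Bool) {x} → p x ≡ false →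
                       countB p ≡ countB (p ∘ punchIn x)
countB-punchIn-false p {x} px =
  ≡.trans (countB-punchIn p x) (cong (λ b → indicator b + countB (p ∘ punchIn x)) px)

countB-punchIn-true : ∀ {n} (p : Fin (suc n) → Bool) {x} → p x ≡ true →
                      countB p ≡ suc (countB (p ∘ punchIn x))
countB-punchIn-true p {x} px =
  ≡.trans (countB-punchIn p x) (cong (λ b → indicator b + countB (p ∘ punchIn x)) px)

countB-cong : ∀ {n} {p q : Fin n → Bool} → p ≗ q → countB p ≡ countB q
countB-cong {n} p≗q = cong sum (map-cong (cong indicator ∘ p≗q) (allFin n))

countB-remove : ∀ {n k} (p : Fin (suc n) → Bool) {x} → p x ≡ true →
                countB p ≡ suc k → countB (p ∘ punchIn x) ≡ k
countB-remove p px c = suc-injective (≡.trans (≡.sym (countB-punchIn-true p px)) c)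

punchOut-true : ∀ {n} (p : Fin (suc n) → Bool) {x w} (x≢w : x ≢ w) → p w ≡ true →
                p (punchIn x (punchOut x≢w)) ≡ true
punchOut-true p x≢w pw = ≡.trans (cong p (punchIn-punchOut x≢w)) pw

countB≡0 : ∀ {n} (p : Fin n → Bool) → countB p ≡ 0 → ∀ {w} → p w ≢ true
countB≡0 {suc n} p c pw = 1+n≢0 (≡.trans (≡.sym (countB-punchIn-true p pw)) c)

countB≡1 : ∀ {n} (p : Fin n → Bool) → countB p ≡ 1 →
           ∀ {x w} → p x ≡ true → p w ≡ true → w ≡ x
countB≡1 {suc n} p c {x} {w} px pw with w ≟ x
... | yes w≡x = w≡x
... | no w≢x = contradiction (punchOut-true p (w≢x ∘ ≡.sym) pw)
                             (countB≡0 (p ∘ punchIn x) (countB-remove p px c))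

countB≡2 : ∀ {n} (p : Fin n → Bool) → countB p ≡ 2 →
           ∀ {x y w} → p x ≡ true → p y ≡ true → x ≢ y → p w ≡ true → w ≡ x ⊎ w ≡ y
countB≡2 {suc n} p c {x} {y} {w} px py x≢y pw with w ≟ x
... | yes w≡x = inj₁ w≡x
... | no w≢x = inj₂ (punchOut-injective x≢w x≢y
        (countB≡1 (p ∘ punchIn x) (countB-remove p px c) (punchOut-true p x≢y py) (punchOut-true p x≢w pw)))
  where
  x≢w : x ≢ w
  x≢w = w≢x ∘ ≡.sym

countB≡3 : ∀ {n} (p : Fin n → Bool) → countB p ≡ 3 →
           ∀ {x y z w} → p x ≡ true → p y ≡ true → p z ≡ true → x ≢ y → x ≢ z → y ≢ z →
           p w ≡ true → w ≡ x ⊎ w ≡ y ⊎ w ≡ z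
countB≡3 {suc n} p c {x} {y} {z} {w} px py pz x≢y x≢z y≢z pw with w ≟ x
... | yes w≡x = inj₁ w≡x
... | no w≢x = inj₂ (Sum.map (punchOut-injective x≢w x≢y) (punchOut-injective x≢w x≢z)
        (countB≡2 (p ∘ punchIn x) (countB-remove p px c)
          (punchOut-true p x≢y py) (punchOut-true p x≢z pz)
          (y≢z ∘ punchOut-injective x≢y x≢z) (punchOut-true p x≢w pw)))
  where
  x≢w : x ≢ w
  x≢w = w≢x ∘ ≡.sym

module _ {n : ℕ} (G : Graph n) where

  adj-sym : ∀ {x y} → adj G x y ≡ true → adj G y x ≡ true
  adj-sym {x} {y} xy = ≡.trans (sym G y x) xy

  adj⇒≢ : ∀ {x y} → adj G x y ≡ true → x ≢ y
  adj⇒≢ {x} xy refl = not-¬ xy (irrefl G x)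

  commonNbrs-comm : ∀ a b → commonNbrs G a b ≡ commonNbrs G b a
  commonNbrs-comm a b = countB-cong (λ w → ∧-comm (adj G a w) (adj G b w))

RemovableVia : ∀ {n} → Graph n → Fin n → Fin n → Fin n → Set
RemovableVia G u a b =
  adj G u a ≡ true × adj G u b ≡ true × adj G a b ≡ true ×
  degree G a ≡ 3 × degree G b ≡ 3 × commonNbrs G a b ≡ 1

module _ {n : ℕ} (G : Graph (suc n)) (u : Fin (suc n)) where

  private
    pI : Fin n → Fin (suc n)
    pI = punchIn u

  punchIn-preimage : ∀ {x} → u ≢ x → ∃[ x₀ ] pI x₀ ≡ x
  punchIn-preimage u≢x = punchOut u≢x , punchIn-punchOut u≢x

  degree-delete : ∀ x → adj G (pI x) u ≡ false → degree (delete G u) x ≡ degree G (pI x)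
  degree-delete x x≁u = ≡.sym (countB-punchIn-false (adj G (pI x)) x≁u)

  commonNbrs-delete : ∀ x y → adj G (pI x) u ≡ false →
                      commonNbrs (delete G u) x y ≡ commonNbrs G (pI x) (pI y)
  commonNbrs-delete x y x≁u =
    ≡.sym (countB-punchIn-false (λ w → adj G (pI x) w ∧ adj G (pI y) w) (cong (_∧ adj G (pI y) u) x≁u))

  nonadjacent-of-degree-delete≡3 : MaxDegree≤3 G → ∀ x → degree (delete G u) x ≡ 3 →
                                   adj G (pI x) u ≡ false
  nonadjacent-of-degree-delete≡3 maxDegree x deg-x = ¬-not λ x∼u →
    n≮n 3 (subst (_≤ 3) (≡.trans (countB-punchIn-true (adj G (pI x)) x∼u) (cong suc deg-x))
                 (maxDegree (pI x)))

  removable-in-delete : ∀ {v c d} → adj G (pI v) u ≡ false → adj G c u ≡ false → adj G d u ≡ false →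
                        degree G (pI v) ≡ 2 → RemovableVia G (pI v) c d → Removable (delete G u) v
  removable-in-delete {v} {c} {d} v≁u c≁u d≁u deg-v (vc , vd , cd , deg-c , deg-d , common-cd)
    with punchIn-preimage {c} (λ { refl → not-¬ vc v≁u }) | punchIn-preimage {d} (λ { refl → not-¬ vd v≁u })
  ... | c , refl | d , refl =
    ≡.trans (degree-delete v v≁u) deg-v , c , d , vc , vd , cd ,
    ≡.trans (degree-delete c c≁u) deg-c , ≡.trans (degree-delete d d≁u) deg-d ,
    ≡.trans (commonNbrs-delete c d c≁u) common-cd

  removable-of-delete : ∀ {v c d} → adj G (pI v) u ≡ false → adj G (pI c) u ≡ false →
                        adj G (pI d) u ≡ false → degree (delete G u) v ≡ 2 →
                        RemovableVia (delete G u) v c d → Removable G (pI v)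
  removable-of-delete {v} {c} {d} v≁u c≁u d≁u deg-v (vc , vd , cd , deg-c , deg-d , common-cd) =
    ≡.trans (≡.sym (degree-delete v v≁u)) deg-v , pI c , pI d , vc , vd , cd ,
    ≡.trans (≡.sym (degree-delete c c≁u)) deg-c , ≡.trans (≡.sym (degree-delete d d≁u)) deg-d ,
    ≡.trans (≡.sym (commonNbrs-delete c d c≁u)) common-cd

third-neighbour-in-no-triangle :
  ∀ {n} (G : Graph n) {u a b x d} → adj G u a ≡ true → adj G u b ≡ true → adj G a b ≡ true →
  degree G a ≡ 3 → commonNbrs G a b ≡ 1 → x ≢ u → adj G x u ≡ false →
  adj G a x ≡ true → adj G a d ≡ true → adj G x d ≡ true → ⊥
third-neighbour-in-no-triangle G {u} {a} {b} {x} u∼a u∼b a∼b deg-a common-ab x≢u x≁u a∼x a∼d x∼d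
  with countB≡3 (adj G a) deg-a (adj-sym G u∼a) a∼b a∼x (adj⇒≢ G u∼b) (x≢u ∘ ≡.sym) b≢x a∼d
  where
  b≢x : b ≢ x
  b≢x refl = not-¬ (adj-sym G u∼b) x≁u
... | inj₁ refl = not-¬ x∼d x≁u
... | inj₂ (inj₁ refl) =
  x≢u (countB≡1 (λ w → adj G a w ∧ adj G b w) common-ab
        (∧-true (adj-sym G u∼a) (adj-sym G u∼b)) (∧-true a∼x (adj-sym G x∼d)))
  where
  ∧-true : ∀ {p q} → p ≡ true → q ≡ true → p ∧ q ≡ true
  ∧-true refl refl = refl
... | inj₂ (inj₂ refl) = adj⇒≢ G x∼d refl

module Removal {n : ℕ} (G : Graph (suc n)) {u a b : Fin (suc n)} (deg-u : degree G u ≡ 2)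
               (u∼a : adj G u a ≡ true) (u∼b : adj G u b ≡ true) (a∼b : adj G a b ≡ true)
               (deg-a : degree G a ≡ 3) (deg-b : degree G b ≡ 3) (common-ab : commonNbrs G a b ≡ 1) where

  neighbour-of-u : ∀ {w} → adj G u w ≡ true → w ≡ a ⊎ w ≡ b
  neighbour-of-u = countB≡2 (adj G u) deg-u u∼a u∼b (adj⇒≢ G a∼b)

  degree-of-neighbour : ∀ {x} → adj G u x ≡ true → degree G x ≡ 3
  degree-of-neighbour u∼x with neighbour-of-u u∼x
  ... | inj₁ refl = deg-a
  ... | inj₂ refl = deg-b

  triangle-partner : ∀ {x} → adj G u x ≡ true → ∃[ y ] adj G x y ≡ true × adj G u y ≡ true
  triangle-partner u∼x with neighbour-of-u u∼x
  ... | inj₁ refl = b , a∼b , u∼b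
  ... | inj₂ refl = a , adj-sym G a∼b , u∼a

  triangle-off-u-misses-u : ∀ {x c d} → x ≢ u → adj G x u ≡ false →
                            adj G x c ≡ true → adj G x d ≡ true → adj G c d ≡ true → adj G c u ≢ true
  triangle-off-u-misses-u x≢u x≁u x∼c x∼d c∼d c∼u with neighbour-of-u (adj-sym G c∼u)
  ... | inj₁ refl =
    third-neighbour-in-no-triangle G u∼a u∼b a∼b deg-a common-ab x≢u x≁u (adj-sym G x∼c) c∼d x∼d
  ... | inj₂ refl =
    third-neighbour-in-no-triangle G u∼b u∼a (adj-sym G a∼b) deg-b
      (≡.trans (commonNbrs-comm G b a) common-ab) x≢u x≁u (adj-sym G x∼c) c∼d x∼d

  removable⇒removable-delete : ∀ v → Removable G (punchIn u v) → Removable (delete G u) v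
  removable⇒removable-delete v (deg-v , c , d , r@(v∼c , v∼d , c∼d , _)) =
    removable-in-delete G u v≁u c≁u d≁u deg-v r
    where
    v≁u : adj G (punchIn u v) u ≡ false
    v≁u = ¬-not λ v∼u →
      contradiction (≡.trans (≡.sym (degree-of-neighbour (adj-sym G v∼u))) deg-v) λ ()
    c≁u : adj G c u ≡ false
    c≁u = ¬-not (triangle-off-u-misses-u (punchInᵢ≢i u v) v≁u v∼c v∼d c∼d)
    d≁u : adj G d u ≡ false
    d≁u = ¬-not (triangle-off-u-misses-u (punchInᵢ≢i u v) v≁u v∼d v∼c (adj-sym G c∼d))

  removable-delete⇒removable : MaxDegree≤3 G → ∀ v → Removable (delete G u) v → Removable G (punchIn u v)
  removable-delete⇒removable maxDegree v (deg-v , c , d , r@(v∼c , v∼d , c∼d , deg-c , deg-d , _)) =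
    removable-of-delete G u v≁u c≁u d≁u deg-v r
    where
    c≁u : adj G (punchIn u c) u ≡ false
    c≁u = nonadjacent-of-degree-delete≡3 G u maxDegree c deg-c
    d≁u : adj G (punchIn u d) u ≡ false
    d≁u = nonadjacent-of-degree-delete≡3 G u maxDegree d deg-d
    neighbour-misses-u : ∀ {y} → u ≢ y → adj G (punchIn u v) y ≡ true → adj G y u ≡ false
    neighbour-misses-u u≢y v∼y with punchIn-preimage G u u≢y
    ... | y , refl with countB≡2 (adj (delete G u) v) deg-v v∼c v∼d (adj⇒≢ (delete G u) c∼d) v∼y
    ...   | inj₁ refl = c≁u
    ...   | inj₂ refl = d≁u
    v≁u : adj G (punchIn u v) u ≡ false
    v≁u = ¬-not λ v∼u → let (y , v∼y , u∼y) = triangle-partner (adj-sym G v∼u) in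
      not-¬ (adj-sym G u∼y) (neighbour-misses-u (adj⇒≢ G u∼y) v∼y)

lemma3p2 : {n : ℕ} (G : Graph (suc n)) → MaxDegree≤3 G →
           (u : Fin (suc n)) → Removable G u →
           (v : Fin n) → Removable (delete G u) v ⇔ Removable G (punchIn u v)
lemma3p2 G maxDegree u (deg-u , a , b , u∼a , u∼b , a∼b , deg-a , deg-b , common-ab) v =
  mk⇔ (removable-delete⇒removable maxDegree v) (removable⇒removable-delete v)
  where open Removal G deg-u u∼a u∼b a∼b deg-a deg-b common-ab
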